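{- Let $(V,\mathcal{G},\mathcal{B})$ be a group divisible design $\mathrm{GDD}(v; K; G_1, G_2, \dots, G_m; 0, 1)$. Suppose there exist $(1,1;3)$-frames of type $6^k$ for each $k \in K$ and an $\mathrm{NR}^*\mathrm{DSTS}(6|G_i|+1)$ for each $i = 1, 2, \dots, m$. Then there exists an $\mathrm{NR}^*\mathrm{DSTS}(6v+1)$.
   Context: A $\mathrm{GDD}(v;K;G_1,\dots,G_m;0,1)$ is a triple $(V,\mathcal{G},\mathcal{B})$ where $|V|=v$, $\mathcal{G}=\{G_1,\dots,G_m\}$ is a partition of $V$ into groups, $\mathcal{B}$ is a set of blocks, each a subset of $V$ of size in $K$, meeting each group in at most one point, and every pair of points from distinct groups lies in exactly one block. A $(1,1;3)$-frame with group partition $\{H_1,\dots,H_n\}$ of a $w$-set $W$ (each $|H_i|$ even) is a square array $F$ of side $w/2$, rows and columns indexed by $0,\dots,w/2-1$, such that: each cell is empty or contains a 3-subset of $W$; with $t_i=|H_i|/2$, $g_k=\sum_{i\le k}t_i$, $g_0=0$, the $t_i\times t_i$ subsquare indexed by $g_{i-1},\dots,g_i-1$ is empty; for $x\in\{g_{i-1},\dots,g_i-1\}$, row $x$ and column $x$ each contain every element of $W\setminus H_i$ exactly once; and the 3-subsets in nonempty cells form a GDD with groups $H_1,\dots,H_n$, block size 3 and index 1. A frame of type $6^k$ is one with $k$ groups each of size $6$. An $\mathrm{STS}(u)$ is a pair $(U,\mathcal{A})$ with $|U|=u$ and $\mathcal{A}$ a family of 3-subsets such that every pair of distinct elements lies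 in exactly one block. A $\mathrm{DSTS}(u)$ is the block collection consisting of two (distinct, labeled) copies of each block of an $\mathrm{STS}(u)$. A near resolution is a partition of the blocks into classes such that each class consists of pairwise disjoint blocks covering $U$ minus exactly one element, and each element is missed by exactly one class; it is self-orthogonal if for any two distinct classes $R_i,R_j$, regarding classes as sets of 3-subsets, $|R_i\cap R_j|\le 1$. An $\mathrm{NR}^*\mathrm{DSTS}(u)$ is a $\mathrm{DSTS}(u)$ with a self-orthogonal near resolution. -}

module Defs where

open import Data.Nat using (ℕ; _*_; _+_)
open import Data.Fin using (Fin; _≟_; quotient)
open import Data.Fin.Subset using (Subset; _∈_; _∉_; ∣_∣)
open import Data.Vec using (tabulate)
open import Data.Maybe using (Maybe; just; nothing)
open import Data.Product using (Σ; Σ-syntax; _×_; _,_; proj₁)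
open import Relation.Binary.PropositionalEquality using (_≡_; _≢_)
open import Relation.Nullary.Decidable using (⌊_⌋)
open import Function.Definitions using (Injective)

ExactlyOne : {n : ℕ} → (Fin n → Set) → Set
ExactlyOne {n} P = Σ (Fin n) P × (∀ i j → P i → P j → i ≡ j)

fibre : {v m : ℕ} → (Fin v → Fin m) → Fin m → Subset v
fibre grp i = tabulate (λ x → ⌊ grp x ≟ i ⌋)

groupSize : {v m : ℕ} → (Fin v → Fin m) → Fin m → ℕ
groupSize grp i = ∣ fibre grp i ∣

-- Groups: grp x = index of the group containing x (partition into m
-- nonempty parts).  Blocks: an injectively indexed family (a set) of
-- subsets of V.
record IsGDD (v m : ℕ) (K : ℕ → Set) (grp : Fin v → Fin m)
             (nb : ℕ) (B : Fin nb → Subset v) : Set where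
  field
    groupsNonempty : ∀ i → Σ (Fin v) (λ x → grp x ≡ i)
    blocksDistinct : Injective _≡_ _≡_ B
    blockSizes     : ∀ j → K ∣ B j ∣
    meetOnce       : ∀ j x y → x ∈ B j → y ∈ B j → grp x ≡ grp y → x ≡ y
    pairsOnce      : ∀ x y → grp x ≢ grp y →
                     ExactlyOne (λ j → x ∈ B j × y ∈ B j)

owner : (k : ℕ) → Fin (k * 3) → Fin k
owner k x = quotient {k} 3 x

-- H a = index of the group containing a (k groups, each of size 6),
-- so t_i = 3, the array has side k * 3 and row/column x (0 ≤ x < 3k)
-- belongs to the group with index ⌊x/3⌋ = owner k x (g_i = 3i).
record IsFrame6 (k : ℕ) (H : Fin (k * 6) → Fin k)
                (F : Fin (k * 3) → Fin (k * 3) → Maybe (Subset (k * 6))) : Set where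
  field
    groupSizes   : ∀ i → groupSize H i ≡ 6
    cellsTriples : ∀ x y T → F x y ≡ just T → ∣ T ∣ ≡ 3
    holesEmpty   : ∀ x y → owner k x ≡ owner k y → F x y ≡ nothing
    rowsOK       : ∀ x a → H a ≢ owner k x →
                   ExactlyOne (λ y → Σ[ T ∈ Subset (k * 6) ] (F x y ≡ just T × a ∈ T))
    colsOK       : ∀ y a → H a ≢ owner k y →
                   ExactlyOne (λ x → Σ[ T ∈ Subset (k * 6) ] (F x y ≡ just T × a ∈ T))
    -- the triples in nonempty cells form a 3-GDD of index 1 with groups H
    cellMeetOnce : ∀ x y T → F x y ≡ just T → ∀ a b → a ∈ T → b ∈ T →
                   H a ≡ H b → a ≡ b
    cellPairs    : ∀ a b → H a ≢ H b →
                   Σ (Fin (k * 3) × Fin (k * 3)) (λ { (x , y) →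
                     Σ[ T ∈ Subset (k * 6) ] (F x y ≡ just T × a ∈ T × b ∈ T) })
    cellPairsUnique : ∀ a b x y x' y' T T' →
                   F x y ≡ just T → a ∈ T → b ∈ T →
                   F x' y' ≡ just T' → a ∈ T' → b ∈ T' → a ≢ b →
                   (x ≡ x' × y ≡ y')

Frame6Exists : ℕ → Set
Frame6Exists k = Σ (Fin (k * 6) → Fin k) λ H →
                 Σ (Fin (k * 3) → Fin (k * 3) → Maybe (Subset (k * 6))) λ F →
                 IsFrame6 k H F

record IsSTS (u nb : ℕ) (A : Fin nb → Subset u) : Set where
  field
    distinct : Injective _≡_ _≡_ A
    triples  : ∀ j → ∣ A j ∣ ≡ 3
    pairs    : ∀ (x y : Fin u) → x ≢ y → ExactlyOne (λ j → x ∈ A j × y ∈ A j)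

-- The DSTS(u) has the labeled blocks (j , c), c : Fin 2, each a copy of A j.
-- A near resolution assigns each labeled block to a class; classes are
-- indexed by the unique element they miss (each class misses exactly one
-- element, each element missed by exactly one class).
record IsNearResolution (u nb : ℕ) (A : Fin nb → Subset u)
                        (cls : Fin nb × Fin 2 → Fin u) : Set where
  field
    missed   : ∀ j l → cls (j , l) ∉ A j
    covers   : ∀ (r x : Fin u) → x ≢ r →
               Σ (Fin nb × Fin 2) (λ p → cls p ≡ r × x ∈ A (proj₁ p))
    disjoint : ∀ (r x : Fin u) (p q : Fin nb × Fin 2) →
               cls p ≡ r → x ∈ A (proj₁ p) → cls q ≡ r → x ∈ A (proj₁ q) →
               p ≡ q

InClass : {u nb : ℕ} → (Fin nb → Subset u) → (Fin nb × Fin 2 → Fin u) →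
          Fin u → Subset u → Set
InClass {u} {nb} A cls r T = Σ (Fin nb × Fin 2) (λ p → cls p ≡ r × A (proj₁ p) ≡ T)

SelfOrthogonal : {u nb : ℕ} → (Fin nb → Subset u) → (Fin nb × Fin 2 → Fin u) → Set
SelfOrthogonal {u} A cls = ∀ (r s : Fin u) → r ≢ s → ∀ (T T' : Subset u) →
  InClass A cls r T → InClass A cls s T → InClass A cls r T' → InClass A cls s T' →
  T ≡ T'

NRDSTS : ℕ → Set
NRDSTS u = Σ ℕ λ nb → Σ (Fin nb → Subset u) λ A →
           IsSTS u nb A × Σ (Fin nb × Fin 2 → Fin u) λ cls →
           IsNearResolution u nb A cls × SelfOrthogonal A cls

{-# OPTIONS --safe #-}
-- Points are ∞ and the pairs (s , x) with s ∈ Z₆ and x ∈ V; the given NR*DSTS(6|Gᵢ|+1) lives on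
-- {∞} ∪ Z₆ × Gᵢ.  On each block B of the GDD lay a (1,1;3)-frame of type 6^|B| whose group for
-- x ∈ B is Z₆ × {x}.  Each filled cell gives two copies of its triple: the first joins the class
-- missing the point that names the cell's row, the second the class missing the point that names
-- its column.  Two points over one group (or involving ∞) are covered by that group's design, two
-- points over different groups by the unique GDD block through them and the unique cell holding
-- both.  The class missing (s , x) is its class in the group design of x together with the line
-- named by (s , x) in every frame through x, and these cover every other point exactly once.
-- Self-orthogonality holds because the two copies of a frame triple miss points over different
-- groups, and a cell is recovered from its row and its column.
module Submission where

open import Axiom.UniquenessOfIdentityProofs.WithK using (uip)
open import Data.Bool using (Bool; true; false)
open import Data.Empty using (⊥; ⊥-elim)
open import Data.Fin using (Fin; zero; suc; _≟_; punchIn; combine; remQuot; quotient; remainder)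
open import Data.Fin.Permutation using (↔⇒≡)
open import Data.Fin.Properties
  using (any?; +↔⊎; *↔×; combine-injective; combine-remQuot; remQuot-combine; <⇒notInjective;
         punchIn-injective; punchInᵢ≢i)
open import Data.Fin.Subset using (Subset; _∈_; ∣_∣)
open import Data.Maybe using (Maybe; just; nothing; maybe)
import Data.Maybe as Maybe
import Data.Maybe.Properties as Maybe
open import Data.Maybe.Properties using (just-injective)
open import Data.Nat using (ℕ; zero; suc; _+_; _*_; _<_; s≤s; z≤n)
open import Data.Nat.Properties using (*-assoc; m<m+n)
open import Data.Product using (Σ; Σ-syntax; ∃-syntax; _×_; _,_; proj₁; proj₂; swap)
import Data.Product as Product
import Data.Product.Properties as Product
open import Data.Product.Algebra using (×-comm)
open import Data.Product.Function.Dependent.Propositional using (Σ-↔)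
open import Data.Sum using (_⊎_; inj₁; inj₂; [_,_])
open import Data.Sum.Function.Propositional using (_⊎-↔_)
open import Data.Unit using (⊤; tt)
open import Data.Vec using ([]; _∷_; here; there; tabulate)
open import Data.Vec.Properties using ([]=⇒lookup; lookup⇒[]=; lookup∘tabulate)
open import Data.Vec.Properties.WithK using ([]=-irrelevant)
open import Function using (_∘_; flip)
open import Function.Bundles using (_↔_; Inverse; Injection; mk↔ₛ′)
open import Function.Definitions using (Injective)
open import Function.Properties.Inverse using (↔-refl; ↔-sym; ↔-trans; ↔⇒↣)
open import Relation.Binary.Definitions using (DecidableEquality)
open import Relation.Binary.PropositionalEquality using (_≡_; _≢_; refl; sym; trans; cong; cong₂; subst)
open import Relation.Nullary.Decidable using (Dec; yes; no; ⌊_⌋)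
open import Relation.Nullary.Negation using (¬_)
open import Relation.Unary using (Decidable)

open import Defs

open Inverse using (to; from; strictlyInverseˡ; strictlyInverseʳ)

to-injective : {A B : Set} (e : A ↔ B) → Injective _≡_ _≡_ (to e)
to-injective e = Injection.injective (↔⇒↣ e)

Finite : Set → Set
Finite A = Σ[ n ∈ ℕ ] (Fin n ↔ A)

Fin-finite : (n : ℕ) → Finite (Fin n)
Fin-finite n = n , ↔-refl

⊎-finite : {A B : Set} → Finite A → Finite B → Finite (A ⊎ B)
⊎-finite (m , eA) (n , eB) = m + n , ↔-trans +↔⊎ (eA ⊎-↔ eB)

Σ-Fin-suc-↔ : {n : ℕ} {P : Fin (suc n) → Set} → Σ (Fin (suc n)) P ↔ (P zero ⊎ Σ (Fin n) (P ∘ suc))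
Σ-Fin-suc-↔ {n} {P} = mk↔ₛ′ split join (λ { (inj₁ _) → refl ; (inj₂ _) → refl })
  (λ { (zero , _) → refl ; (suc _ , _) → refl })
  where
  split : Σ (Fin (suc n)) P → P zero ⊎ Σ (Fin n) (P ∘ suc)
  split (zero , p) = inj₁ p
  split (suc i , p) = inj₂ (i , p)
  join : P zero ⊎ Σ (Fin n) (P ∘ suc) → Σ (Fin (suc n)) P
  join (inj₁ p) = zero , p
  join (inj₂ (i , p)) = suc i , p

Σ-Fin-finite : {m : ℕ} {P : Fin m → Set} → (∀ i → Finite (P i)) → Finite (Σ (Fin m) P)
Σ-Fin-finite {zero} _ = 0 , mk↔ₛ′ (λ ()) (λ ()) (λ ()) (λ ())
Σ-Fin-finite {suc m} fin with fin zero | Σ-Fin-finite (fin ∘ suc)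
... | a , e₀ | b , eₛ = a + b , ↔-trans +↔⊎ (↔-trans (e₀ ⊎-↔ eₛ) (↔-sym Σ-Fin-suc-↔))

Σ-finite : {A : Set} {P : A → Set} → Finite A → (∀ a → Finite (P a)) → Finite (Σ A P)
Σ-finite (n , e) fin with Σ-Fin-finite (fin ∘ to e)
... | N , e′ = N , ↔-trans e′ (Σ-↔ e ↔-refl)

just-finite : {A : Set} (m : Maybe A) → Finite (∃[ a ] m ≡ just a)
just-finite nothing = 0 , mk↔ₛ′ (λ ()) (λ ()) (λ ()) (λ ())
just-finite (just a) =
  1 , mk↔ₛ′ (λ _ → a , refl) (λ _ → zero) (λ { (_ , refl) → refl }) (λ { zero → refl })

⊎-Fin1↔Maybe : {A : Set} → (A ⊎ Fin 1) ↔ Maybe A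
⊎-Fin1↔Maybe = mk↔ₛ′ [ just , (λ _ → nothing) ] (maybe inj₁ (inj₂ zero))
  (λ { (just _) → refl ; nothing → refl }) (λ { (inj₁ _) → refl ; (inj₂ zero) → refl })

opaque
  *+1↔Maybe× : {m n : ℕ} → Fin (m * n + 1) ↔ Maybe (Fin m × Fin n)
  *+1↔Maybe× = ↔-trans +↔⊎ (↔-trans (*↔× ⊎-↔ ↔-refl) ⊎-Fin1↔Maybe)

∈-tail-↔ : {n : ℕ} {b : Bool} {p : Subset n} {x : Fin n} → x ∈ p ↔ suc x ∈ b ∷ p
∈-tail-↔ = mk↔ₛ′ there (λ { (there h) → h }) (λ { (there h) → refl }) (λ _ → refl)

enumerate-∷ : {n c : ℕ} {b : Bool} {p : Subset n} → Fin c ↔ (zero ∈ b ∷ p) →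
              Fin ∣ p ∣ ↔ Σ (Fin n) (_∈ p) → Fin (c + ∣ p ∣) ↔ Σ (Fin (suc n)) (_∈ b ∷ p)
enumerate-∷ head rest =
  ↔-trans +↔⊎ (↔-trans (head ⊎-↔ ↔-trans rest (Σ-↔ ↔-refl ∈-tail-↔)) (↔-sym Σ-Fin-suc-↔))

enumerate : {n : ℕ} (p : Subset n) → Fin ∣ p ∣ ↔ Σ (Fin n) (_∈ p)
enumerate [] = mk↔ₛ′ (λ ()) (λ ()) (λ ()) (λ ())
enumerate (true ∷ p) = enumerate-∷ head (enumerate p)
  where
  head : Fin 1 ↔ (zero ∈ true ∷ p)
  head = mk↔ₛ′ (λ _ → here) (λ _ → zero) (λ { here → refl }) (λ { zero → refl })
enumerate (false ∷ p) = enumerate-∷ head (enumerate p)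
  where
  head : Fin 0 ↔ (zero ∈ false ∷ p)
  head = mk↔ₛ′ (λ ()) (λ ()) (λ ()) (λ ())

∈-Σ-≡ : {n : ℕ} {p : Subset n} {x y : Fin n} {h : x ∈ p} {h′ : y ∈ p} →
        x ≡ y → _≡_ {A = Σ (Fin n) (_∈ p)} (x , h) (y , h′)
∈-Σ-≡ refl = cong (_ ,_) ([]=-irrelevant _ _)

module Listing {n k : ℕ} (p : Subset n) (∣p∣≡k : ∣ p ∣ ≡ k) where

  opaque
    listing : Fin k ↔ Σ (Fin n) (_∈ p)
    listing = subst (λ s → Fin s ↔ Σ (Fin n) (_∈ p)) ∣p∣≡k (enumerate p)

  element : Fin k → Fin n
  element i = proj₁ (to listing i)

  element-∈ : ∀ i → element i ∈ p
  element-∈ i = proj₂ (to listing i)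

  element-injective : Injective _≡_ _≡_ element
  element-injective eq = to-injective listing (∈-Σ-≡ eq)

  index : {x : Fin n} → x ∈ p → Fin k
  index {x} x∈p = from listing (x , x∈p)

  element-index : {x : Fin n} (x∈p : x ∈ p) → element (index x∈p) ≡ x
  element-index {x} x∈p = cong proj₁ (strictlyInverseˡ listing (x , x∈p))

module ThreeSubset {n : ℕ} (S : Subset n) (∣S∣≡3 : ∣ S ∣ ≡ 3) where
  open Listing S ∣S∣≡3 public

  module _ {X : Set} (f : Fin n → X) where

    image : Fin 3 → X
    image = f ∘ element

    image-injective : Injective _≡_ _≡_ f → Injective _≡_ _≡_ image
    image-injective f-injective = element-injective ∘ f-injective

    ∈-image⁻ : ∀ {x} → ∃[ c ] image c ≡ x → ∃[ y ] (y ∈ S × f y ≡ x)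
    ∈-image⁻ (c , eq) = element c , element-∈ c , eq

    ∈-image⁺ : ∀ {y} → y ∈ S → ∃[ c ] image c ≡ f y
    ∈-image⁺ y∈S = index y∈S , cong f (element-index y∈S)

    ∈-image⇒∈ : Injective _≡_ _≡_ f → ∀ {y} → ∃[ c ] image c ≡ f y → y ∈ S
    ∈-image⇒∈ f-injective (c , eq) = subst (_∈ S) (f-injective eq) (element-∈ c)

  module _ {a : Fin n} (a∈S : a ∈ S) where

    others : Fin 2 → Fin n
    others l = element (punchIn (index a∈S) l)

    others-∈ : ∀ l → others l ∈ S
    others-∈ l = element-∈ _

    others-≢ : ∀ l → others l ≢ a
    others-≢ l eq = punchInᵢ≢i (index a∈S) l (element-injective (trans eq (sym (element-index a∈S))))

    others-injective : Injective _≡_ _≡_ others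
    others-injective eq = punchIn-injective (index a∈S) _ _ (element-injective eq)

∈-tabulate⁺ : {n : ℕ} {P : Fin n → Set} (P? : Decidable P) {x : Fin n} →
              P x → x ∈ tabulate (λ y → ⌊ P? y ⌋)
∈-tabulate⁺ {P = P} P? {x} px = lookup⇒[]= x _ (trans (lookup∘tabulate _ x) (holds (P? x)))
  where
  holds : (d : Dec (P x)) → ⌊ d ⌋ ≡ true
  holds (yes _) = refl
  holds (no ¬px) = ⊥-elim (¬px px)

∈-tabulate⁻ : {n : ℕ} {P : Fin n → Set} (P? : Decidable P) {x : Fin n} →
              x ∈ tabulate (λ y → ⌊ P? y ⌋) → P x
∈-tabulate⁻ {P = P} P? {x} x∈ = witness (P? x) (trans (sym (lookup∘tabulate _ x)) ([]=⇒lookup x∈))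
  where
  witness : (d : Dec (P x)) → ⌊ d ⌋ ≡ true → P x
  witness (yes px) _ = px

∈-fibre⁺ : {n m : ℕ} (f : Fin n → Fin m) {i : Fin m} {x : Fin n} → f x ≡ i → x ∈ fibre f i
∈-fibre⁺ f {i} = ∈-tabulate⁺ (λ y → f y ≟ i)

∈-fibre⁻ : {n m : ℕ} (f : Fin n → Fin m) {i : Fin m} {x : Fin n} → x ∈ fibre f i → f x ≡ i
∈-fibre⁻ f {i} = ∈-tabulate⁻ (λ y → f y ≟ i)

fibres-↔ : {n m : ℕ} (f : Fin n → Fin m) → Fin n ↔ Σ (Fin m) (λ i → Σ (Fin n) (_∈ fibre f i))
fibres-↔ f = mk↔ₛ′ (λ x → f x , x , ∈-fibre⁺ f refl) (λ (_ , x , _) → x) inverse (λ _ → refl)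
  where
  inverse : ∀ y → (f (proj₁ (proj₂ y)) , proj₁ (proj₂ y) , ∈-fibre⁺ f refl) ≡ y
  inverse (i , x , x∈) with ∈-fibre⁻ f x∈
  ... | refl = cong (λ h → f x , x , h) ([]=-irrelevant _ _)

opaque
  equal-fibres-↔ : {n m k : ℕ} (f : Fin n → Fin m) → (∀ i → groupSize f i ≡ k) → Fin n ↔ (Fin k × Fin m)
  equal-fibres-↔ f sizes =
    ↔-trans (fibres-↔ f) (↔-trans (Σ-↔ ↔-refl (↔-sym (Listing.listing (fibre f _) (sizes _)))) (×-comm _ _))

  equal-fibres-↔-proj₂ : {n m k : ℕ} (f : Fin n → Fin m) (sizes : ∀ i → groupSize f i ≡ k) (x : Fin n) →
                         proj₂ (to (equal-fibres-↔ f sizes) x) ≡ f x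
  equal-fibres-↔-proj₂ f sizes x = refl

-- Blocks are given as injective triples of points; the copies of block b are (b , 0) and (b , 1),
-- and, as in IsNearResolution, a class is named by the point it misses.
record NRDSTSOn (X I : Set) : Set where
  field
    point : I → Fin 3 → X
    point-injective : ∀ b → Injective _≡_ _≡_ (point b)
    class : I × Fin 2 → X

  _∈ᵇ_ : X → I → Set
  x ∈ᵇ b = ∃[ c ] point b c ≡ x

  field
    pair-covered : ∀ {x y} → x ≢ y → ∃[ b ] (x ∈ᵇ b × y ∈ᵇ b)
    pair-unique : ∀ {x y} → x ≢ y → ∀ b b′ →
                  x ∈ᵇ b → y ∈ᵇ b → x ∈ᵇ b′ → y ∈ᵇ b′ → b ≡ b′
    class-misses : ∀ p → ¬ (class p ∈ᵇ proj₁ p)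
    class-covers : ∀ {r x} → x ≢ r → ∃[ p ] (class p ≡ r × x ∈ᵇ proj₁ p)
    class-disjoint : ∀ {x} p q → class p ≡ class q → x ∈ᵇ proj₁ p → x ∈ᵇ proj₁ q → p ≡ q
    self-orthogonal : ∀ b b′ {l l′ m m′} → class (b , l) ≢ class (b , l′) →
                      class (b , l) ≡ class (b′ , m) → class (b , l′) ≡ class (b′ , m′) → b ≡ b′

module Relabel {X I : Set} (D : NRDSTSOn X I) (_≟ˣ_ : DecidableEquality X)
               {u N : ℕ} (pts : Fin u ↔ X) (blks : Fin N ↔ I) where
  open NRDSTSOn D

  _∈ᵇ?_ : ∀ x b → Dec (x ∈ᵇ b)
  x ∈ᵇ? b = any? (λ c → point b c ≟ˣ x)

  block : Fin N → Subset u
  block n = tabulate (λ z → ⌊ to pts z ∈ᵇ? to blks n ⌋)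

  cls : Fin N × Fin 2 → Fin u
  cls (n , l) = from pts (class (to blks n , l))

  ∈-block⁺ : ∀ {z n} → to pts z ∈ᵇ to blks n → z ∈ block n
  ∈-block⁺ {n = n} = ∈-tabulate⁺ (λ z → to pts z ∈ᵇ? to blks n)

  ∈-block⁻ : ∀ {z n} → z ∈ block n → to pts z ∈ᵇ to blks n
  ∈-block⁻ {n = n} = ∈-tabulate⁻ (λ z → to pts z ∈ᵇ? to blks n)

  ∈-block-from : ∀ {z b} → to pts z ∈ᵇ b → z ∈ block (from blks b)
  ∈-block-from {z} {b} = ∈-block⁺ ∘ subst (to pts z ∈ᵇ_) (sym (strictlyInverseˡ blks b))

  to-pts-≢ : ∀ {z z′} → z ≢ z′ → to pts z ≢ to pts z′
  to-pts-≢ z≢z′ = z≢z′ ∘ to-injective pts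

  from-pts-injective : Injective _≡_ _≡_ (from pts)
  from-pts-injective = to-injective (↔-sym pts)

  point-∈-block : ∀ n c → from pts (point (to blks n) c) ∈ block n
  point-∈-block n c = ∈-block⁺ (c , sym (strictlyInverseˡ pts _))

  block-points : ∀ n → Fin 3 ↔ Σ (Fin u) (_∈ block n)
  block-points n = mk↔ₛ′ (λ c → _ , point-∈-block n c) (λ (_ , z∈) → proj₁ (∈-block⁻ z∈))
    (λ (z , z∈) → ∈-Σ-≡ (trans (cong (from pts) (proj₂ (∈-block⁻ z∈))) (strictlyInverseʳ pts z)))
    (λ c → point-injective _ (trans (proj₂ (∈-block⁻ (point-∈-block n c))) (strictlyInverseˡ pts _)))

  block-injective : ∀ {n n′} → block n ≡ block n′ → n ≡ n′
  block-injective {n} {n′} eq = to-injective blks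
    (pair-unique (to-pts-≢ (0≢1 ∘ point-injective _ ∘ from-pts-injective)) _ _
      (∈-block⁻ (point-∈-block n zero)) (∈-block⁻ (point-∈-block n (suc zero)))
      (∈-block⁻ (moved zero)) (∈-block⁻ (moved (suc zero))))
    where
    0≢1 : zero ≢ suc zero
    0≢1 ()
    moved : ∀ c → from pts (point (to blks n) c) ∈ block n′
    moved c = subst (from pts (point (to blks n) c) ∈_) eq (point-∈-block n c)

  isSTS : IsSTS u N block
  isSTS = record
    { distinct = block-injective
    ; triples = λ n → sym (↔⇒≡ (↔-trans (block-points n) (↔-sym (enumerate (block n)))))
    ; pairs = λ z z′ z≢z′ → pair (pair-covered (to-pts-≢ z≢z′)) ,
        λ n n′ (z∈ , z′∈) (z∈′ , z′∈′) → to-injective blks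
          (pair-unique (to-pts-≢ z≢z′) _ _
            (∈-block⁻ z∈) (∈-block⁻ z′∈) (∈-block⁻ z∈′) (∈-block⁻ z′∈′))
    }
    where
    pair : ∀ {z z′} → ∃[ b ] (to pts z ∈ᵇ b × to pts z′ ∈ᵇ b) →
           ∃[ n ] (z ∈ block n × z′ ∈ block n)
    pair (b , z∈ , z′∈) = from blks b , ∈-block-from z∈ , ∈-block-from z′∈

  isNearResolution : IsNearResolution u N block cls
  isNearResolution = record
    { missed = λ n l r∈ →
        class-misses (to blks n , l) (subst (_∈ᵇ to blks n) (strictlyInverseˡ pts _) (∈-block⁻ r∈))
    ; covers = λ r z z≢r → cover (class-covers (to-pts-≢ z≢r))
    ; disjoint = λ { r z (n , l) (n′ , l′) refl z∈ r≡ z∈′ →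
        disjoint (from-pts-injective (sym r≡)) z∈ z∈′ }
    }
    where
    cover : ∀ {r z} → ∃[ p ] (class p ≡ to pts r × to pts z ∈ᵇ proj₁ p) →
            ∃[ p ] (cls p ≡ r × z ∈ block (proj₁ p))
    cover {r} ((b , l) , r≡ , z∈) =
      (from blks b , l) ,
      trans (cong (λ b′ → from pts (class (b′ , l))) (strictlyInverseˡ blks b))
            (trans (cong (from pts) r≡) (strictlyInverseʳ pts r)) ,
      ∈-block-from z∈
    disjoint : ∀ {z n l n′ l′} → class (to blks n , l) ≡ class (to blks n′ , l′) →
               z ∈ block n → z ∈ block n′ → (n , l) ≡ (n′ , l′)
    disjoint r≡ z∈ z∈′ =
      let p≡q = class-disjoint _ _ r≡ (∈-block⁻ z∈) (∈-block⁻ z∈′)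
      in cong₂ _,_ (to-injective blks (cong proj₁ p≡q)) (cong proj₂ p≡q)

  selfOrthogonal : SelfOrthogonal block cls
  selfOrthogonal _ _ r≢s _ _ ((n₁ , l₁) , refl , refl) ((n₂ , l₂) , refl , same₂)
                             ((n₃ , l₃) , r₃ , refl) ((n₄ , l₄) , s₄ , same₄)
    with block-injective same₂ | block-injective same₄
  ... | refl | refl = cong block (to-injective blks
    (self-orthogonal _ _ (r≢s ∘ cong (from pts)) (sym (from-pts-injective r₃)) (sym (from-pts-injective s₄))))

  nrdsts : NRDSTS u
  nrdsts = N , block , isSTS , cls , isNearResolution , selfOrthogonal

transpose : {k : ℕ} {H : Fin (k * 6) → Fin k} {F : Fin (k * 3) → Fin (k * 3) → Maybe (Subset (k * 6))} →
            IsFrame6 k H F → IsFrame6 k H (flip F)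
transpose fr = record
  { groupSizes = groupSizes
  ; cellsTriples = λ x y → cellsTriples y x
  ; holesEmpty = λ x y eq → holesEmpty y x (sym eq)
  ; rowsOK = colsOK
  ; colsOK = rowsOK
  ; cellMeetOnce = λ x y → cellMeetOnce y x
  ; cellPairs = λ a b Ha≢Hb → let ((x , y) , cell) = cellPairs a b Ha≢Hb in (y , x) , cell
  ; cellPairsUnique = λ a b x y x′ y′ T T′ e a∈ b∈ e′ a∈′ b∈′ a≢b →
      swap (cellPairsUnique a b y x y′ x′ T T′ e a∈ b∈ e′ a∈′ b∈′ a≢b)
  }
  where open IsFrame6 fr

module FrameCells {k : ℕ} {H : Fin (k * 6) → Fin k} {F : Fin (k * 3) → Fin (k * 3) → Maybe (Subset (k * 6))}
                  (fr : IsFrame6 k H F) where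
  open IsFrame6 fr

  Cell : Set
  Cell = Fin (k * 3) × Fin (k * 3)

  entry : Cell → Maybe (Subset (k * 6))
  entry (x , y) = F x y

  Filled : Set
  Filled = Σ[ c ∈ Cell ] ∃[ T ] entry c ≡ just T

  filled-finite : Finite Filled
  filled-finite = Σ-finite (k * 3 * (k * 3) , *↔×) (just-finite ∘ entry)

  filled-≡ : ∀ {c c′ T T′} {e : entry c ≡ just T} {e′ : entry c′ ≡ just T′} →
             c ≡ c′ → _≡_ {A = Filled} (c , T , e) (c′ , T′ , e′)
  filled-≡ {e = e} {e′} refl with just-injective (trans (sym e) e′)
  ... | refl = cong (λ e″ → _ , _ , e″) (uip e e′)

  cell-size : ∀ {c T} → entry c ≡ just T → ∣ T ∣ ≡ 3
  cell-size {x , y} = cellsTriples x y _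

  _∈ᶜ_ : Fin (k * 6) → Cell → Set
  a ∈ᶜ c = ∃[ T ] (entry c ≡ just T × a ∈ T)

  ∈ᶜ-irrelevant : ∀ {a c} (p q : a ∈ᶜ c) → p ≡ q
  ∈ᶜ-irrelevant (T , e , a∈T) (T′ , e′ , a∈T′) with just-injective (trans (sym e) e′)
  ... | refl with uip e e′ | []=-irrelevant a∈T a∈T′
  ... | refl | refl = refl

  cell-groups-distinct : ∀ {a b c} → a ∈ᶜ c → b ∈ᶜ c → a ≢ b → H a ≢ H b
  cell-groups-distinct {c = x , y} (T , e , a∈T) (T′ , e′ , b∈T′) a≢b with just-injective (trans (sym e) e′)
  ... | refl = a≢b ∘ cellMeetOnce x y T e _ _ a∈T b∈T′

  cell-unique : ∀ {a b c c′} → a ≢ b → a ∈ᶜ c → b ∈ᶜ c → a ∈ᶜ c′ → b ∈ᶜ c′ → c ≡ c′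
  cell-unique {c = x , y} {x′ , y′} a≢b
              (T , e , a∈T) (T₂ , e₂ , b∈T₂) (T′ , e′ , a∈T′) (T₂′ , e₂′ , b∈T₂′)
    with just-injective (trans (sym e) e₂) | just-injective (trans (sym e′) e₂′)
  ... | refl | refl =
    let (x≡ , y≡) = cellPairsUnique _ _ x y x′ y′ T T′ e a∈T b∈T₂ e′ a∈T′ b∈T₂′ a≢b
    in cong₂ _,_ x≡ y≡

  module _ {a : Fin (k * 6)} {c : Cell} (a∈c : a ∈ᶜ c) where
    private
      T = proj₁ a∈c
      e = proj₁ (proj₂ a∈c)
      a∈T = proj₂ (proj₂ a∈c)

    partner : Fin 2 → Fin (k * 6)
    partner = ThreeSubset.others T (cell-size e) a∈T

    partner-∈ᶜ : ∀ l → partner l ∈ᶜ c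
    partner-∈ᶜ l = T , e , ThreeSubset.others-∈ T (cell-size e) a∈T l

    partner-≢ : ∀ l → partner l ≢ a
    partner-≢ = ThreeSubset.others-≢ T (cell-size e) a∈T

    partner-injective : Injective _≡_ _≡_ partner
    partner-injective = ThreeSubset.others-injective T (cell-size e) a∈T

    partner-other-group : ∀ l → H (partner l) ≢ H a
    partner-other-group l = cell-groups-distinct (partner-∈ᶜ l) a∈c (partner-≢ l)

  partner-unique : ∀ {a c c′} (a∈c : a ∈ᶜ c) (a∈c′ : a ∈ᶜ c′) {l l′} →
                   partner a∈c l ≡ partner a∈c′ l′ → c ≡ c′ × l ≡ l′
  partner-unique a∈c a∈c′ {l} {l′} eq
    with cell-unique (partner-≢ a∈c l ∘ sym) a∈c (partner-∈ᶜ a∈c l)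
                     a∈c′ (subst (_∈ᶜ _) (sym eq) (partner-∈ᶜ a∈c′ l′))
  ... | refl with ∈ᶜ-irrelevant a∈c a∈c′
  ... | refl = refl , partner-injective a∈c eq

module FrameRows {k : ℕ} {H : Fin (k * 6) → Fin k} {F : Fin (k * 3) → Fin (k * 3) → Maybe (Subset (k * 6))}
                 (fr : IsFrame6 k H F) where
  open IsFrame6 fr
  open FrameCells fr

  -- IsFrame6 only says that row x meets every point outside the group of x exactly once.  If a
  -- occurred in row x₀ of its own group, then the partners of a in its cells on the 3k - 3 rows of
  -- the other groups, the 6 points of its group (charged to its own 3 rows) and its 2 partners in
  -- row x₀ would give 6k + 2 distinct points among 6k.
  row-avoids-owner : ∀ {a x y} → a ∈ᶜ (x , y) → H a ≢ owner k x
  row-avoids-owner {a} {x₀} a∈c₀ Ha≡ = <⇒notInjective too-many (to-injective domain ∘ ι-injective)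
    where
    member : Fin 6 → Fin (k * 6)
    member = Listing.element (fibre H (H a)) (groupSizes (H a))

    member-H : ∀ i → H (member i) ≡ H a
    member-H i = ∈-fibre⁻ H (Listing.element-∈ (fibre H (H a)) (groupSizes (H a)) i)

    witness : ∀ x → Dec (owner k x ≡ H a) → Fin 2 → Fin (k * 6)
    witness x (yes _) l = member (combine (remainder {k} 3 x) l)
    witness x (no x≢) l = partner (proj₂ (proj₁ (rowsOK x a (x≢ ∘ sym)))) l

    witness-injective : ∀ {x x′} d d′ {l l′} → witness x d l ≡ witness x′ d′ l′ → (x , l) ≡ (x′ , l′)
    witness-injective {x} {x′} (yes x≡) (yes x′≡) {l} {l′} eq
      with combine-injective (remainder {k} 3 x) l (remainder {k} 3 x′) l′
             (Listing.element-injective (fibre H (H a)) (groupSizes (H a)) eq)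
    ... | r≡ , refl = cong (_, l) (to-injective (*↔× {k} {3}) (cong₂ _,_ (trans x≡ (sym x′≡)) r≡))
    witness-injective (yes _) (no _) {l′ = l′} eq =
      ⊥-elim (partner-other-group _ l′ (trans (cong H (sym eq)) (member-H _)))
    witness-injective (no _) (yes _) {l} eq = ⊥-elim (partner-other-group _ l (trans (cong H eq) (member-H _)))
    witness-injective (no _) (no _) eq with partner-unique _ _ eq
    ... | refl , refl = refl

    witness-≢-partner : ∀ {x} d l l′ → witness x d l ≢ partner a∈c₀ l′
    witness-≢-partner (yes _) l l′ eq = partner-other-group a∈c₀ l′ (trans (cong H (sym eq)) (member-H _))
    witness-≢-partner (no x≢) l l′ eq with partner-unique _ _ eq
    ... | refl , _ = x≢ (sym Ha≡)

    ι : (Fin (k * 3) × Fin 2) ⊎ Fin 2 → Fin (k * 6)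
    ι (inj₁ (x , l)) = witness x (owner k x ≟ H a) l
    ι (inj₂ l) = partner a∈c₀ l

    ι-injective : Injective _≡_ _≡_ ι
    ι-injective {inj₁ (x , _)} {inj₁ (x′ , _)} eq =
      cong inj₁ (witness-injective (owner k x ≟ H a) (owner k x′ ≟ H a) eq)
    ι-injective {inj₁ (x , l)} {inj₂ l′} eq = ⊥-elim (witness-≢-partner (owner k x ≟ H a) l l′ eq)
    ι-injective {inj₂ l} {inj₁ (x , l′)} eq = ⊥-elim (witness-≢-partner (owner k x ≟ H a) l′ l (sym eq))
    ι-injective {inj₂ _} {inj₂ _} eq = cong inj₂ (partner-injective a∈c₀ eq)

    domain : Fin (k * 3 * 2 + 2) ↔ ((Fin (k * 3) × Fin 2) ⊎ Fin 2)
    domain = ↔-trans +↔⊎ (*↔× ⊎-↔ ↔-refl)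

    too-many : k * 6 < k * 3 * 2 + 2
    too-many = subst (λ t → k * 6 < t + 2) (sym (*-assoc k 3 2)) (m<m+n (k * 6) (s≤s z≤n))

module FrameLines {k : ℕ} {H : Fin (k * 6) → Fin k} {F : Fin (k * 3) → Fin (k * 3) → Maybe (Subset (k * 6))}
                  (fr : IsFrame6 k H F) where
  open IsFrame6 fr
  open FrameCells fr public

  line : Fin 2 → Cell → Fin (k * 3)
  line zero = proj₁
  line (suc zero) = proj₂

  line-avoids-owner : ∀ l {a c} → a ∈ᶜ c → H a ≢ owner k (line l c)
  line-avoids-owner zero = FrameRows.row-avoids-owner fr
  line-avoids-owner (suc zero) {c = x , y} = FrameRows.row-avoids-owner (transpose fr) {x = y} {y = x}

  line-exists : ∀ l x {a} → H a ≢ owner k x → ∃[ c ] (line l c ≡ x × a ∈ᶜ c)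
  line-exists zero x Ha≢ = let (y , a∈c) , _ = rowsOK x _ Ha≢ in (x , y) , refl , a∈c
  line-exists (suc zero) y Ha≢ = let (x , a∈c) , _ = colsOK y _ Ha≢ in (x , y) , refl , a∈c

  line-unique : ∀ l {a c c′} → line l c ≡ line l c′ → a ∈ᶜ c → a ∈ᶜ c′ → c ≡ c′
  line-unique zero {a} {x , y} {.x , y′} refl a∈c a∈c′ =
    cong (x ,_) (proj₂ (rowsOK x a (line-avoids-owner zero a∈c)) y y′ a∈c a∈c′)
  line-unique (suc zero) {a} {x , y} {x′ , .y} refl a∈c a∈c′ =
    cong (_, y) (proj₂ (colsOK y a (line-avoids-owner (suc zero) a∈c)) x x′ a∈c a∈c′)

  lines-owned-apart : ∀ {l l′} → l ≢ l′ → ∀ {c T} → entry c ≡ just T →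
                      owner k (line l c) ≢ owner k (line l′ c)
  lines-owned-apart {zero} {zero} l≢l′ = ⊥-elim (l≢l′ refl)
  lines-owned-apart {zero} {suc zero} _ {x , y} e eq with trans (sym e) (holesEmpty x y eq)
  ... | ()
  lines-owned-apart {suc zero} {zero} _ {x , y} e eq with trans (sym e) (holesEmpty x y (sym eq))
  ... | ()
  lines-owned-apart {suc zero} {suc zero} l≢l′ = ⊥-elim (l≢l′ refl)

  cell-from-lines : ∀ {l l′} → l ≢ l′ → ∀ {c c′} →
                    line l c ≡ line l c′ → line l′ c ≡ line l′ c′ → c ≡ c′
  cell-from-lines {zero} {zero} l≢l′ = ⊥-elim (l≢l′ refl)
  cell-from-lines {zero} {suc zero} _ x≡ y≡ = cong₂ _,_ x≡ y≡
  cell-from-lines {suc zero} {zero} _ y≡ x≡ = cong₂ _,_ x≡ y≡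
  cell-from-lines {suc zero} {suc zero} l≢l′ = ⊥-elim (l≢l′ refl)

module Ingredient {u : ℕ} (D : NRDSTS u) where

  nblocks : ℕ
  nblocks = proj₁ D

  block : Fin nblocks → Subset u
  block = proj₁ (proj₂ D)

  isSTS : IsSTS u nblocks block
  isSTS = proj₁ (proj₂ (proj₂ D))

  class : Fin nblocks × Fin 2 → Fin u
  class = proj₁ (proj₂ (proj₂ (proj₂ D)))

  isNearResolution : IsNearResolution u nblocks block class
  isNearResolution = proj₁ (proj₂ (proj₂ (proj₂ (proj₂ D))))

  selfOrthogonal : SelfOrthogonal block class
  selfOrthogonal = proj₂ (proj₂ (proj₂ (proj₂ (proj₂ D))))

module Construction (v m : ℕ) (K : ℕ → Set) (grp : Fin v → Fin m) (nb : ℕ) (B : Fin nb → Subset v)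
                    (gdd : IsGDD v m K grp nb B) (frames : ∀ k → K k → Frame6Exists k)
                    (designs : ∀ i → NRDSTS (6 * groupSize grp i + 1)) where
  open IsGDD gdd

  Point : Set
  Point = Maybe (Fin 6 × Fin v)

  _≟ᵖ_ : DecidableEquality Point
  _≟ᵖ_ = Maybe.≡-dec (Product.≡-dec _≟_ _≟_)

  InGroup : Fin m → Point → Set
  InGroup i nothing = ⊤
  InGroup i (just (_ , x)) = grp x ≡ i

  same-group : ∀ {i i′ x y} → x ≢ y →
               InGroup i x → InGroup i y → InGroup i′ x → InGroup i′ y → i ≡ i′
  same-group {x = just _} _ refl _ refl _ = refl
  same-group {x = nothing} {just _} _ _ refl _ refl = refl
  same-group {x = nothing} {nothing} x≢y = ⊥-elim (x≢y refl)

  data Placement : Point → Point → Set where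
    together : ∀ {x y} i → InGroup i x → InGroup i y → Placement x y
    apart : ∀ {s x t y} → grp x ≢ grp y → Placement (just (s , x)) (just (t , y))

  placement : ∀ x y → x ≢ y → Placement x y
  placement nothing nothing x≢y = ⊥-elim (x≢y refl)
  placement nothing (just (_ , y)) _ = together (grp y) tt refl
  placement (just (_ , x)) nothing _ = together (grp x) refl tt
  placement (just (_ , x)) (just (_ , y)) _ with grp x ≟ grp y
  ... | yes gx≡gy = together (grp x) refl (sym gx≡gy)
  ... | no gx≢gy = apart gx≢gy

  module Group (i : Fin m) where
    open Ingredient (designs i) public

    size : ℕ
    size = groupSize grp i

    member : Fin size → Fin v
    member = Listing.element (fibre grp i) refl

    embed : Maybe (Fin 6 × Fin size) → Point
    embed = Maybe.map (Product.map₂ member)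

    embed-in-group : ∀ y → InGroup i (embed y)
    embed-in-group nothing = tt
    embed-in-group (just (_ , z)) = ∈-fibre⁻ grp (Listing.element-∈ (fibre grp i) refl z)

    point : Fin (6 * size + 1) → Point
    point = embed ∘ to *+1↔Maybe×

    point-injective : Injective _≡_ _≡_ point
    point-injective = to-injective *+1↔Maybe× ∘ Maybe.map-injective map₂-member-injective
      where
      map₂-member-injective : Injective _≡_ _≡_ (Product.map₂ {A = Fin 6} member)
      map₂-member-injective eq =
        cong₂ _,_ (cong proj₁ eq) (Listing.element-injective (fibre grp i) refl (cong proj₂ eq))

    point-in-group : ∀ w → InGroup i (point w)
    point-in-group w = embed-in-group (to *+1↔Maybe× w)

    point-onto : ∀ {x} → InGroup i x → ∃[ w ] point w ≡ x
    point-onto {x} x∈i =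
      from *+1↔Maybe× (local x x∈i) ,
      trans (cong embed (strictlyInverseˡ *+1↔Maybe× (local x x∈i))) (embed-local x x∈i)
      where
      local : ∀ x → InGroup i x → Maybe (Fin 6 × Fin size)
      local nothing _ = nothing
      local (just (s , y)) gy≡i = just (s , Listing.index (fibre grp i) refl (∈-fibre⁺ grp gy≡i))
      embed-local : ∀ x x∈i → embed (local x x∈i) ≡ x
      embed-local nothing _ = refl
      embed-local (just (s , y)) gy≡i =
        cong (λ z → just (s , z)) (Listing.element-index (fibre grp i) refl (∈-fibre⁺ grp gy≡i))

  module Frame (j : Fin nb) where

    k : ℕ
    k = ∣ B j ∣

    H : Fin (k * 6) → Fin k
    H = proj₁ (frames k (blockSizes j))

    fr : IsFrame6 k H (proj₁ (proj₂ (frames k (blockSizes j))))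
    fr = proj₂ (proj₂ (frames k (blockSizes j)))

    open FrameLines fr public

    member : Fin k → Fin v
    member = Listing.element (B j) refl

    member-∈ : ∀ h → member h ∈ B j
    member-∈ = Listing.element-∈ (B j) refl

    member-grp-injective : ∀ {h h′} → grp (member h) ≡ grp (member h′) → h ≡ h′
    member-grp-injective eq = Listing.element-injective (B j) refl (meetOnce j _ _ (member-∈ _) (member-∈ _) eq)

    member-apart : ∀ {i h h′} → h ≢ h′ → grp (member h) ≡ i → grp (member h′) ≡ i → ⊥
    member-apart h≢h′ refl eq = h≢h′ (member-grp-injective (sym eq))

    at : Fin 6 → Fin k → Point
    at s h = just (s , member h)

    at-injective : ∀ {s s′ h h′} → at s h ≡ at s′ h′ → s ≡ s′ × h ≡ h′
    at-injective eq =
      cong proj₁ (just-injective eq) , Listing.element-injective (B j) refl (cong proj₂ (just-injective eq))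

    coordinates : Fin (k * 6) ↔ (Fin 6 × Fin k)
    coordinates = equal-fibres-↔ H (IsFrame6.groupSizes fr)

    H-coordinate : ∀ a → proj₂ (to coordinates a) ≡ H a
    H-coordinate = equal-fibres-↔-proj₂ H (IsFrame6.groupSizes fr)

    point : Fin (k * 6) → Point
    point a = at (proj₁ (to coordinates a)) (H a)

    point-injective : Injective _≡_ _≡_ point
    point-injective {a} {a′} eq =
      let (s≡ , h≡) = at-injective eq
      in to-injective coordinates (cong₂ _,_ s≡ (trans (H-coordinate a) (trans h≡ (sym (H-coordinate a′)))))

    point-onto : ∀ s h → ∃[ a ] (point a ≡ at s h × H a ≡ h)
    point-onto s h = a , cong₂ at (cong proj₁ coords) Ha≡h , Ha≡h
      where
      a = from coordinates (s , h)
      coords = strictlyInverseˡ coordinates (s , h)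
      Ha≡h = trans (sym (H-coordinate a)) (cong proj₂ coords)

    -- The three rows (l = 0) of the frame group of member h are named by the first three points
    -- of Z₆ × {member h}, its three columns (l = 1) by the last three.
    linePoint : Fin 2 → Fin (k * 3) → Point
    linePoint l x = at (combine l (remainder {k} 3 x)) (owner k x)

    linePoint-injective : ∀ {l l′ x x′} → linePoint l x ≡ linePoint l′ x′ → l ≡ l′ × x ≡ x′
    linePoint-injective {l} {l′} {x} {x′} eq with at-injective eq
    ... | s≡ , h≡ with combine-injective l (remainder {k} 3 x) l′ (remainder {k} 3 x′) s≡
    ...   | l≡ , r≡ = l≡ , to-injective (*↔× {k} {3}) (cong₂ _,_ h≡ r≡)

    linePoint-onto : ∀ s h → ∃[ l ] ∃[ x ] (linePoint l x ≡ at s h × owner k x ≡ h)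
    linePoint-onto s h = l , combine h r , cong₂ at slot (cong proj₁ position) , cong proj₁ position
      where
      l = quotient {2} 3 s
      r = remainder {2} 3 s
      position : remQuot {k} 3 (combine h r) ≡ (h , r)
      position = remQuot-combine h r
      slot : combine l (remainder {k} 3 (combine h r)) ≡ s
      slot = trans (cong (combine l) (cong proj₂ position)) (combine-remQuot {2} 3 s)

  same-frame : ∀ {j j′ s₁ s₂ s₁′ s₂′ h₁ h₂ h₁′ h₂′} → h₁ ≢ h₂ →
               Frame.at j s₁ h₁ ≡ Frame.at j′ s₁′ h₁′ →
               Frame.at j s₂ h₂ ≡ Frame.at j′ s₂′ h₂′ → j ≡ j′
  same-frame {j} {j′} h₁≢h₂ eq₁ eq₂ =
    proj₂ (pairsOnce _ _ (h₁≢h₂ ∘ Frame.member-grp-injective j)) j j′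
      (Frame.member-∈ j _ , Frame.member-∈ j _)
      (subst (_∈ B j′) (sym (member≡ eq₁)) (Frame.member-∈ j′ _) ,
       subst (_∈ B j′) (sym (member≡ eq₂)) (Frame.member-∈ j′ _))
    where
    member≡ : ∀ {s s′ h h′} → Frame.at j s h ≡ Frame.at j′ s′ h′ →
              Frame.member j h ≡ Frame.member j′ h′
    member≡ eq = cong proj₂ (just-injective eq)

  common-frame : ∀ {x y} → grp x ≢ grp y →
                 ∃[ j ] ∃[ h ] ∃[ h′ ] (Frame.member j h ≡ x × Frame.member j h′ ≡ y)
  common-frame gx≢gy =
    let (j , x∈ , y∈) , _ = pairsOnce _ _ gx≢gy
    in j , _ , _ , Listing.element-index (B j) refl x∈ , Listing.element-index (B j) refl y∈

  FrameBlock : Set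
  FrameBlock = Σ[ j ∈ Fin nb ] Frame.Filled j

  Block : Set
  Block = (Σ[ i ∈ Fin m ] Fin (Group.nblocks i)) ⊎ FrameBlock

  block-finite : Finite Block
  block-finite = ⊎-finite (Σ-Fin-finite (Fin-finite ∘ Group.nblocks)) (Σ-Fin-finite Frame.filled-finite)

  module GroupTriple (i : Fin m) (t : Fin (Group.nblocks i)) =
    ThreeSubset (Group.block i t) (IsSTS.triples (Group.isSTS i) t)

  module FrameTriple (f : FrameBlock) =
    ThreeSubset (proj₁ (proj₂ (proj₂ f))) (Frame.cell-size (proj₁ f) (proj₂ (proj₂ (proj₂ f))))

  triple : Block → Fin 3 → Point
  triple (inj₁ (i , t)) = GroupTriple.image i t (Group.point i)
  triple (inj₂ f) = FrameTriple.image f (Frame.point (proj₁ f))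

  triple-injective : ∀ b → Injective _≡_ _≡_ (triple b)
  triple-injective (inj₁ (i , t)) = GroupTriple.image-injective i t _ (Group.point-injective i)
  triple-injective (inj₂ f) = FrameTriple.image-injective f _ (Frame.point-injective (proj₁ f))

  class : Block × Fin 2 → Point
  class (inj₁ (i , t) , l) = Group.point i (Group.class i (t , l))
  class (inj₂ (j , c , _) , l) = Frame.linePoint j l (Frame.line j l c)

  _∈ᵇ_ : Point → Block → Set
  x ∈ᵇ b = ∃[ c ] triple b c ≡ x

  ∈ᵇ-group : ∀ {i t x} → x ∈ᵇ inj₁ (i , t) → ∃[ w ] (w ∈ Group.block i t × Group.point i w ≡ x)
  ∈ᵇ-group {i} {t} = GroupTriple.∈-image⁻ i t (Group.point i)

  ∈ᵇ-group⁺ : ∀ {i t w} → w ∈ Group.block i t → Group.point i w ∈ᵇ inj₁ (i , t)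
  ∈ᵇ-group⁺ {i} {t} = GroupTriple.∈-image⁺ i t (Group.point i)

  ∈ᵇ-group⁻ : ∀ {i t w} → Group.point i w ∈ᵇ inj₁ (i , t) → w ∈ Group.block i t
  ∈ᵇ-group⁻ {i} {t} = GroupTriple.∈-image⇒∈ i t (Group.point i) (Group.point-injective i)

  ∈ᵇ-group-in-group : ∀ {i t x} → x ∈ᵇ inj₁ (i , t) → InGroup i x
  ∈ᵇ-group-in-group {i} x∈ with ∈ᵇ-group x∈
  ... | w , _ , refl = Group.point-in-group i w

  ∈ᵇ-frame : ∀ {j c T e x} → x ∈ᵇ inj₂ (j , c , T , e) → ∃[ a ] (a ∈ T × Frame.point j a ≡ x)
  ∈ᵇ-frame {j} {c} {T} {e} = FrameTriple.∈-image⁻ (j , c , T , e) (Frame.point j)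

  ∈ᵇ-frame⁺ : ∀ {j c T e a} → a ∈ T → Frame.point j a ∈ᵇ inj₂ (j , c , T , e)
  ∈ᵇ-frame⁺ {j} {c} {T} {e} = FrameTriple.∈-image⁺ (j , c , T , e) (Frame.point j)

  class-in-group : ∀ i t l → InGroup i (class (inj₁ (i , t) , l))
  class-in-group i t l = Group.point-in-group i (Group.class i (t , l))

  frame-block-spans-groups : ∀ f {i x y} → x ≢ y →
                             x ∈ᵇ inj₂ f → y ∈ᵇ inj₂ f → InGroup i x → InGroup i y → ⊥
  frame-block-spans-groups (j , c , T , e) x≢y x∈ y∈ with ∈ᵇ-frame x∈ | ∈ᵇ-frame y∈
  ... | a , a∈T , refl | a′ , a′∈T , refl =
    Frame.member-apart j (Frame.cell-groups-distinct j (T , e , a∈T) (T , e , a′∈T) (x≢y ∘ cong (Frame.point j)))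

  frame-class-outside-group : ∀ f l {i x} → x ∈ᵇ inj₂ f →
                              InGroup i x → InGroup i (class (inj₂ f , l)) → ⊥
  frame-class-outside-group (j , c , T , e) l x∈ with ∈ᵇ-frame x∈
  ... | a , a∈T , refl = Frame.member-apart j (Frame.line-avoids-owner j l (T , e , a∈T))

  frame-classes-apart : ∀ f {i l l′} → l ≢ l′ →
                        InGroup i (class (inj₂ f , l)) → InGroup i (class (inj₂ f , l′)) → ⊥
  frame-classes-apart (j , c , T , e) l≢l′ = Frame.member-apart j (Frame.lines-owned-apart j l≢l′ e)

  group-pair : ∀ i {w w′} → w ≢ w′ → ∃[ b ] (Group.point i w ∈ᵇ b × Group.point i w′ ∈ᵇ b)
  group-pair i w≢w′ =
    let (t , w∈ , w′∈) , _ = IsSTS.pairs (Group.isSTS i) _ _ w≢w′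
    in inj₁ (i , t) , ∈ᵇ-group⁺ w∈ , ∈ᵇ-group⁺ w′∈

  frame-pair : ∀ j {s s′ h h′} → h ≢ h′ → ∃[ b ] (Frame.at j s h ∈ᵇ b × Frame.at j s′ h′ ∈ᵇ b)
  frame-pair j {s} {s′} {h} {h′} h≢h′ with Frame.point-onto j s h | Frame.point-onto j s′ h′
  ... | a , a≡ , refl | a′ , a′≡ , refl =
    let (c , T , e , a∈T , a′∈T) = IsFrame6.cellPairs (Frame.fr j) a a′ h≢h′
        b = inj₂ (j , c , T , e)
    in b , subst (_∈ᵇ b) a≡ (∈ᵇ-frame⁺ a∈T) , subst (_∈ᵇ b) a′≡ (∈ᵇ-frame⁺ a′∈T)

  pair-covered : ∀ {x y} → x ≢ y → ∃[ b ] (x ∈ᵇ b × y ∈ᵇ b)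
  pair-covered {x} {y} x≢y with placement x y x≢y
  ... | together i x∈i y∈i with Group.point-onto i x∈i | Group.point-onto i y∈i
  ...   | w , refl | w′ , refl = group-pair i (x≢y ∘ cong (Group.point i))
  pair-covered x≢y | apart gx≢gy with common-frame gx≢gy
  ... | j , h , h′ , refl , refl = frame-pair j (gx≢gy ∘ cong (grp ∘ Frame.member j))

  group-pair-unique : ∀ i {t t′ x y} → x ≢ y → x ∈ᵇ inj₁ (i , t) → y ∈ᵇ inj₁ (i , t) →
                      x ∈ᵇ inj₁ (i , t′) → y ∈ᵇ inj₁ (i , t′) → t ≡ t′
  group-pair-unique i x≢y x∈ y∈ x∈′ y∈′ with ∈ᵇ-group x∈ | ∈ᵇ-group y∈
  ... | w , w∈ , refl | w′ , w′∈ , refl =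
    proj₂ (IsSTS.pairs (Group.isSTS i) w w′ (x≢y ∘ cong (Group.point i))) _ _
      (w∈ , w′∈) (∈ᵇ-group⁻ x∈′ , ∈ᵇ-group⁻ y∈′)

  frame-pair-unique : ∀ f f′ {x y} → x ≢ y →
                      x ∈ᵇ inj₂ f → y ∈ᵇ inj₂ f → x ∈ᵇ inj₂ f′ → y ∈ᵇ inj₂ f′ → f ≡ f′
  frame-pair-unique (j , c , T , e) (j′ , c′ , T′ , e′) x≢y x∈ y∈ x∈′ y∈′
    with ∈ᵇ-frame x∈ | ∈ᵇ-frame y∈ | ∈ᵇ-frame x∈′ | ∈ᵇ-frame y∈′
  ... | a , a∈T , refl | b , b∈T , refl | a′ , a′∈T′ , a′≡ | b′ , b′∈T′ , b′≡
    with same-frame (Frame.cell-groups-distinct j (T , e , a∈T) (T , e , b∈T) (x≢y ∘ cong (Frame.point j)))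
                    (sym a′≡) (sym b′≡)
  ... | refl with Frame.point-injective j a′≡ | Frame.point-injective j b′≡
  ... | refl | refl = cong (j ,_) (Frame.filled-≡ j
    (Frame.cell-unique j (x≢y ∘ cong (Frame.point j))
      (T , e , a∈T) (T , e , b∈T) (T′ , e′ , a′∈T′) (T′ , e′ , b′∈T′)))

  pair-unique : ∀ {x y} → x ≢ y → ∀ b b′ → x ∈ᵇ b → y ∈ᵇ b → x ∈ᵇ b′ → y ∈ᵇ b′ → b ≡ b′
  pair-unique x≢y (inj₁ (i , t)) (inj₁ (i′ , t′)) x∈ y∈ x∈′ y∈′
    with same-group x≢y (∈ᵇ-group-in-group x∈) (∈ᵇ-group-in-group y∈)
                        (∈ᵇ-group-in-group x∈′) (∈ᵇ-group-in-group y∈′)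
  ... | refl = cong (λ t → inj₁ (i , t)) (group-pair-unique i x≢y x∈ y∈ x∈′ y∈′)
  pair-unique x≢y (inj₁ _) (inj₂ f) x∈ y∈ x∈′ y∈′ =
    ⊥-elim (frame-block-spans-groups f x≢y x∈′ y∈′ (∈ᵇ-group-in-group x∈) (∈ᵇ-group-in-group y∈))
  pair-unique x≢y (inj₂ f) (inj₁ _) x∈ y∈ x∈′ y∈′ =
    ⊥-elim (frame-block-spans-groups f x≢y x∈ y∈ (∈ᵇ-group-in-group x∈′) (∈ᵇ-group-in-group y∈′))
  pair-unique x≢y (inj₂ f) (inj₂ f′) x∈ y∈ x∈′ y∈′ =
    cong inj₂ (frame-pair-unique f f′ x≢y x∈ y∈ x∈′ y∈′)

  class-misses : ∀ p → ¬ (class p ∈ᵇ proj₁ p)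
  class-misses (inj₁ (i , t) , l) r∈ = IsNearResolution.missed (Group.isNearResolution i) t l (∈ᵇ-group⁻ r∈)
  class-misses (inj₂ (j , c , T , e) , l) r∈ with ∈ᵇ-frame r∈
  ... | a , a∈T , a≡ = Frame.line-avoids-owner j l (T , e , a∈T) (proj₂ (Frame.at-injective j a≡))

  group-cover : ∀ i {w w′} → w ≢ w′ →
                ∃[ p ] (class p ≡ Group.point i w′ × Group.point i w ∈ᵇ proj₁ p)
  group-cover i w≢w′ =
    let (t , l) , cls≡ , w∈ = IsNearResolution.covers (Group.isNearResolution i) _ _ w≢w′
    in (inj₁ (i , t) , l) , cong (Group.point i) cls≡ , ∈ᵇ-group⁺ w∈

  frame-cover : ∀ j {s s′ h h′} → h ≢ h′ →
                ∃[ p ] (class p ≡ Frame.at j s′ h′ × Frame.at j s h ∈ᵇ proj₁ p)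
  frame-cover j {s} {s′} {h} {h′} h≢h′ with Frame.linePoint-onto j s′ h′ | Frame.point-onto j s h
  ... | l , x , x≡ , refl | a , a≡ , refl =
    let (c , line≡ , T , e , a∈T) = Frame.line-exists j l x h≢h′
        b = inj₂ (j , c , T , e)
    in (b , l) , trans (cong (Frame.linePoint j l) line≡) x≡ , subst (_∈ᵇ b) a≡ (∈ᵇ-frame⁺ a∈T)

  class-covers : ∀ {r x} → x ≢ r → ∃[ p ] (class p ≡ r × x ∈ᵇ proj₁ p)
  class-covers {r} {x} x≢r with placement x r x≢r
  ... | together i x∈i r∈i with Group.point-onto i x∈i | Group.point-onto i r∈i
  ...   | w , refl | w′ , refl = group-cover i (x≢r ∘ cong (Group.point i))
  class-covers x≢r | apart gx≢gr with common-frame gx≢gr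
  ... | j , h , h′ , refl , refl = frame-cover j (gx≢gr ∘ cong (grp ∘ Frame.member j))

  group-disjoint : ∀ i {t t′ l l′ x} → class (inj₁ (i , t) , l) ≡ class (inj₁ (i , t′) , l′) →
                   x ∈ᵇ inj₁ (i , t) → x ∈ᵇ inj₁ (i , t′) → (t , l) ≡ (t′ , l′)
  group-disjoint i r≡ x∈ x∈′ with ∈ᵇ-group x∈
  ... | w , w∈ , refl = IsNearResolution.disjoint (Group.isNearResolution i) _ w _ _ refl w∈
                          (sym (Group.point-injective i r≡)) (∈ᵇ-group⁻ x∈′)

  frame-disjoint : ∀ f f′ {l l′ x} → class (inj₂ f , l) ≡ class (inj₂ f′ , l′) →
                   x ∈ᵇ inj₂ f → x ∈ᵇ inj₂ f′ → (f , l) ≡ (f′ , l′)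
  frame-disjoint (j , c , T , e) (j′ , c′ , T′ , e′) {l} {l′} r≡ x∈ x∈′
    with ∈ᵇ-frame x∈ | ∈ᵇ-frame x∈′
  ... | a , a∈T , refl | a′ , a′∈T′ , a′≡
    with same-frame (Frame.line-avoids-owner j l (T , e , a∈T)) (sym a′≡) r≡
  ... | refl with Frame.point-injective j a′≡
                | Frame.linePoint-injective j {l} {l′} {Frame.line j l c} {Frame.line j l′ c′} r≡
  ... | refl | refl , line≡ =
    cong (λ c → (j , c) , l)
      (Frame.filled-≡ j (Frame.line-unique j l line≡ (T , e , a∈T) (T′ , e′ , a′∈T′)))

  class-disjoint : ∀ {x} p q → class p ≡ class q → x ∈ᵇ proj₁ p → x ∈ᵇ proj₁ q → p ≡ q
  class-disjoint (inj₁ (i , t) , l) (inj₁ (i′ , t′) , l′) r≡ x∈ x∈′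
    with same-group (λ x≡r → class-misses (inj₁ (i , t) , l) (subst (_∈ᵇ inj₁ (i , t)) x≡r x∈))
           (∈ᵇ-group-in-group x∈) (class-in-group i t l)
           (∈ᵇ-group-in-group x∈′) (subst (InGroup i′) (sym r≡) (class-in-group i′ t′ l′))
  ... | refl = cong (λ (t , l) → inj₁ (i , t) , l) (group-disjoint i r≡ x∈ x∈′)
  class-disjoint (inj₁ (i , t) , l) (inj₂ f , l′) r≡ x∈ x∈′ =
    ⊥-elim (frame-class-outside-group f l′ x∈′
      (∈ᵇ-group-in-group x∈) (subst (InGroup i) r≡ (class-in-group i t l)))
  class-disjoint (inj₂ f , l) (inj₁ (i , t) , l′) r≡ x∈ x∈′ =
    ⊥-elim (frame-class-outside-group f l x∈
      (∈ᵇ-group-in-group x∈′) (subst (InGroup i) (sym r≡) (class-in-group i t l′)))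
  class-disjoint (inj₂ f , l) (inj₂ f′ , l′) r≡ x∈ x∈′ =
    cong (λ (f , l) → inj₂ f , l) (frame-disjoint f f′ r≡ x∈ x∈′)

  labels-apart : ∀ b {l l′} → class (b , l) ≢ class (b , l′) → l ≢ l′
  labels-apart b r≢s l≡l′ = r≢s (cong (λ l → class (b , l)) l≡l′)

  group-self-orthogonal : ∀ i {t t′ l l′ m m′} → class (inj₁ (i , t) , l) ≢ class (inj₁ (i , t) , l′) →
                          class (inj₁ (i , t) , l) ≡ class (inj₁ (i , t′) , m) →
                          class (inj₁ (i , t) , l′) ≡ class (inj₁ (i , t′) , m′) → t ≡ t′
  group-self-orthogonal i {t} {t′} {l} {l′} {m} {m′} r≢s r≡ s≡ =
    IsSTS.distinct (Group.isSTS i) (Group.selfOrthogonal i _ _ (r≢s ∘ cong (Group.point i)) _ _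
      ((t , l) , refl , refl) ((t , l′) , refl , refl)
      ((t′ , m) , sym (Group.point-injective i r≡) , refl) ((t′ , m′) , sym (Group.point-injective i s≡) , refl))

  frame-self-orthogonal : ∀ f f′ {l l′ m m′} → l ≢ l′ →
                          class (inj₂ f , l) ≡ class (inj₂ f′ , m) →
                          class (inj₂ f , l′) ≡ class (inj₂ f′ , m′) → f ≡ f′
  frame-self-orthogonal (j , c , T , e) (j′ , c′ , T′ , e′) {l} {l′} {m} {m′} l≢l′ r≡ s≡
    with same-frame (Frame.lines-owned-apart j l≢l′ e) r≡ s≡
  ... | refl with Frame.linePoint-injective j {l} {m} {Frame.line j l c} {Frame.line j m c′} r≡
                | Frame.linePoint-injective j {l′} {m′} {Frame.line j l′ c} {Frame.line j m′ c′} s≡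
  ... | refl , x≡ | refl , x′≡ = cong (j ,_) (Frame.filled-≡ j (Frame.cell-from-lines j l≢l′ x≡ x′≡))

  self-orthogonal : ∀ b b′ {l l′ m m′} → class (b , l) ≢ class (b , l′) →
                    class (b , l) ≡ class (b′ , m) → class (b , l′) ≡ class (b′ , m′) → b ≡ b′
  self-orthogonal (inj₁ (i , t)) (inj₁ (i′ , t′)) {l} {l′} {m} {m′} r≢s r≡ s≡
    with same-group r≢s (class-in-group i t l) (class-in-group i t l′)
           (subst (InGroup i′) (sym r≡) (class-in-group i′ t′ m))
           (subst (InGroup i′) (sym s≡) (class-in-group i′ t′ m′))
  ... | refl = cong (λ t → inj₁ (i , t)) (group-self-orthogonal i r≢s r≡ s≡)
  self-orthogonal (inj₁ (i , t)) (inj₂ f) {l} {l′} {m} {m′} r≢s r≡ s≡ =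
    ⊥-elim (frame-classes-apart f {i} {m} {m′}
      (labels-apart (inj₂ f) (r≢s ∘ λ r′≡s′ → trans r≡ (trans r′≡s′ (sym s≡))))
      (subst (InGroup i) r≡ (class-in-group i t l)) (subst (InGroup i) s≡ (class-in-group i t l′)))
  self-orthogonal (inj₂ f) (inj₁ (i , t)) {l} {l′} {m} {m′} r≢s r≡ s≡ =
    ⊥-elim (frame-classes-apart f {i} {l} {l′} (labels-apart (inj₂ f) r≢s)
      (subst (InGroup i) (sym r≡) (class-in-group i t m)) (subst (InGroup i) (sym s≡) (class-in-group i t m′)))
  self-orthogonal (inj₂ f) (inj₂ f′) {l} {l′} {m} {m′} r≢s r≡ s≡ =
    cong inj₂ (frame-self-orthogonal f f′ {l} {l′} {m} {m′} (labels-apart (inj₂ f) r≢s) r≡ s≡)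

  design : NRDSTSOn Point Block
  design = record
    { point = triple
    ; point-injective = triple-injective
    ; class = class
    ; pair-covered = pair-covered
    ; pair-unique = pair-unique
    ; class-misses = class-misses
    ; class-covers = class-covers
    ; class-disjoint = class-disjoint
    ; self-orthogonal = self-orthogonal
    }

theorem4p1 : (v m : ℕ) (K : ℕ → Set) (grp : Fin v → Fin m)
             (nb : ℕ) (B : Fin nb → Subset v) →
             IsGDD v m K grp nb B →
             (∀ k → K k → Frame6Exists k) →
             (∀ i → NRDSTS (6 * groupSize grp i + 1)) →
             NRDSTS (6 * v + 1)
theorem4p1 v m K grp nb B gdd frames designs =
  Relabel.nrdsts design _≟ᵖ_ *+1↔Maybe× (proj₂ block-finite)
  where open Construction v m K grp nb B gdd frames designs
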